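{- Let $n\ge1$ and let $a_1<a_2<\dots<a_n$ be positive integers. Then $$\sum_{\pi\in\mathfrak{B}_{\{a_1,\dots,a_n\}}}(-1)^{\mathsf{inv}_B(\pi)}t^{\mathsf{des}_B(\pi)}s^{\mathsf{asc}_B(\pi)}u^{\mathsf{pos}_{a_n}(\pi)}=(s-t)^n u^n.$$
   Context: $\mathfrak{B}_{\{a_1,\dots,a_n\}}$ is the set of all bijections $\pi$ of $\{\pm a_1,\dots,\pm a_n\}$ with $\pi(-x)=-\pi(x)$ (so it has $2^nn!$ elements); write $\pi_{a_i}=\pi(a_i)$, and set $a_0=0$, $\pi_{a_0}=0$. Define $\mathsf{inv}_B(\pi)=|\{1\le i<j\le n:\pi_{a_i}>\pi_{a_j}\}|+|\{1\le i<j\le n:-\pi_{a_i}>\pi_{a_j}\}|+|\{i\in[n]:\pi_{a_i}<0\}|$, $\mathsf{des}_B(\pi)=|\{i\in\{0,\dots,n-1\}:\pi_{a_i}>\pi_{a_{i+1}}\}|$, $\mathsf{asc}_B(\pi)=|\{i\in\{0,\dots,n-1\}:\pi_{a_i}<\pi_{a_{i+1}}\}|$, and $\mathsf{pos}_{a_n}(\pi)=k$ where $|\pi_{a_k}|=a_n$. -}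

module Defs where

open import Data.Nat as ℕ using (ℕ; zero; suc)
open import Data.Integer as ℤ using (ℤ; +_; -_; _<_; _<?_; _^_; ∣_∣)
open import Data.Fin using (Fin)
open import Data.List using (List; []; _∷_; map; concatMap; filter; length; foldr)
open import Data.List.Relation.Unary.AllPairs using (AllPairs; allPairs?)
open import Relation.Nullary using (¬_; does)
open import Data.Bool using (Bool; if_then_else_)
open import Data.List.Base using () renaming (filterᵇ to filterᵇ)
open import Relation.Nullary.Decidable using (¬?)
open import Relation.Binary.PropositionalEquality using (_≡_)
open import Data.Fin.Base using (toℕ)
open import Data.List.Base using (allFin)

-- A signed bijection π of {±a₁,…,±aₙ} (π(-x) = -π(x)) is determined by the
-- list of integer values [π(a₁), …, π(aₙ)]; such a list is exactly a list of
-- length n with entries in {±a₁,…,±aₙ} whose absolute values are pairwise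
-- distinct.

signedValues : {n : ℕ} → (Fin n → ℕ) → List ℤ
signedValues {n} a = concatMap (λ j → (+ a j) ∷ (- (+ a j)) ∷ []) (allFin n)

words : List ℤ → ℕ → List (List ℤ)
words xs zero = [] ∷ []
words xs (suc k) = concatMap (λ x → map (x ∷_) (words xs k)) xs

DistinctAbs : ℤ → ℤ → Set
DistinctAbs x y = ¬ (∣ x ∣ ≡ ∣ y ∣)

signedBijections : {n : ℕ} → (Fin n → ℕ) → List (List ℤ)
signedBijections {n} a =
  filter (allPairs? (λ x y → ¬? (∣ x ∣ ℕ.≟ ∣ y ∣))) (words (signedValues a) n)

_<ᵇ_ : ℤ → ℤ → Bool
x <ᵇ y = does (x <? y)

countPairs : (ℤ → ℤ → Bool) → List ℤ → ℕ
countPairs p [] = 0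
countPairs p (x ∷ ys) = length (filterᵇ (p x) ys) ℕ.+ countPairs p ys

countAdj : (ℤ → ℤ → Bool) → List ℤ → ℕ
countAdj p [] = 0
countAdj p (x ∷ []) = 0
countAdj p (x ∷ y ∷ ys) = (if p x y then 1 else 0) ℕ.+ countAdj p (y ∷ ys)

invB : List ℤ → ℕ
invB xs = countPairs (λ x y → y <ᵇ x) xs
      ℕ.+ countPairs (λ x y → y <ᵇ (- x)) xs
      ℕ.+ length (filterᵇ (λ x → x <ᵇ (+ 0)) xs)

-- des_B / asc_B over positions 0..n-1 with π_{a₀} = 0
desB : List ℤ → ℕ
desB xs = countAdj (λ x y → y <ᵇ x) ((+ 0) ∷ xs)

ascB : List ℤ → ℕ
ascB xs = countAdj (λ x y → x <ᵇ y) ((+ 0) ∷ xs)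

-- the (1-based) position k with |x_k| = v (0 if none)
posOfAbs : ℕ → List ℤ → ℕ
posOfAbs v [] = 0
posOfAbs v (x ∷ xs) = if ∣ x ∣ ℕ.≡ᵇ v then 1 else suc (posOfAbs v xs)

genSum : {n : ℕ} → (Fin n → ℕ) → ℕ → ℤ → ℤ → ℤ → ℤ
genSum a aₙ t s u = foldr ℤ._+_ (+ 0) (map (λ π → ((- (+ 1)) ^ invB π) ℤ.* (t ^ desB π) ℤ.* (s ^ ascB π) ℤ.* (u ^ posOfAbs aₙ π)) (signedBijections a))

module Submission where

-- Deleting the first letter x of x ∷ w changes inv_B, modulo 2,
-- by [x < 0] plus the number of later letters of smaller absolute value
-- (inv-cons-parity).  So that the recursion closes up we study the sum
-- S k F p u over words of length k that avoid a list F of already used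
-- absolute values, follow a letter p, and carry the sign of the inversions
-- between F and the word.  Grouping its first letters in pairs ±b, the two
-- remaining sums coincide (they depend only on b), the signs differ, and the
-- ascent/descent weights against p give (s - t) when b > |p| and cancel when
-- b < |p|.  Hence S k F p u = coeff k F |p| · ((s - t) u)ᵏ (partial-closed-form),
-- where coeff is a signed count of increasing chains; for F = [] and p = 0 it
-- counts the increasing n-chains in a₁ < … < aₙ, of which there is exactly one.

open import Defs
open import Data.Nat as ℕ using (ℕ; zero; suc; _<_)
open import Data.Fin using (Fin; fromℕ; toℕ; zero)
import Data.Nat.Properties as ℕP
import Data.Nat.Tactic.RingSolver as ℕSolver
open import Data.Integer using (ℤ; +_; -_; -[1+_]; ∣_∣; _-_; _*_; _^_) renaming (_+_ to _⊕_)
import Data.Integer.Properties as ℤP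
open import Data.Integer.Tactic.RingSolver using (solve-∀)
open import Data.Bool using (Bool; true; false; _∧_; not; if_then_else_; T; T?)
open import Data.Bool.Properties using (∧-zeroʳ)
open import Data.List using (List; []; _∷_; map; concatMap; concat; filter; length; foldr; _++_; tabulate)
open import Data.List.Base using (filterᵇ)
open import Data.List.Properties using (map-tabulate; length-tabulate; length-filter)
open import Data.List.Membership.Propositional using (_∈_)
open import Data.List.Relation.Unary.Any using (here; there)
open import Data.List.Relation.Unary.All as All using (All; []; _∷_; all?)
import Data.List.Relation.Unary.All.Properties as AllP
open import Data.List.Relation.Unary.AllPairs using (AllPairs; allPairs?)
import Data.List.Relation.Unary.AllPairs.Core as AllPairs
import Data.List.Relation.Unary.AllPairs.Properties as AllPairsP
import Data.Fin.Properties as FinP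
open import Data.Product using (_×_; _,_; proj₁; proj₂)
open import Data.Sum using (inj₁; inj₂)
open import Data.Empty using (⊥-elim)
open import Function using (id)
open import Relation.Nullary using (does; ¬_)
open import Relation.Nullary.Decidable using (¬?)
import Relation.Unary
open import Relation.Binary.Definitions using (tri<; tri≈; tri>)
open import Relation.Binary.PropositionalEquality
  using (_≡_; _≢_; refl; sym; trans; cong; cong₂; subst; module ≡-Reasoning)

∑ : {A : Set} → List A → (A → ℤ) → ℤ
∑ xs f = foldr _⊕_ (+ 0) (map f xs)

∑-++ : {A : Set} (xs ys : List A) (f : A → ℤ) → ∑ (xs ++ ys) f ≡ ∑ xs f ⊕ ∑ ys f
∑-++ [] ys f = sym (ℤP.+-identityˡ _)
∑-++ (x ∷ xs) ys f = trans (cong (f x ⊕_) (∑-++ xs ys f)) (sym (ℤP.+-assoc (f x) _ _))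

∑-map : {A B : Set} (g : A → B) (xs : List A) (f : B → ℤ) → ∑ (map g xs) f ≡ ∑ xs (λ x → f (g x))
∑-map g [] f = refl
∑-map g (x ∷ xs) f = cong (f (g x) ⊕_) (∑-map g xs f)

∑-concat : {A : Set} (xss : List (List A)) (f : A → ℤ) → ∑ (concat xss) f ≡ ∑ xss (λ xs → ∑ xs f)
∑-concat [] f = refl
∑-concat (xs ∷ xss) f = trans (∑-++ xs (concat xss) f) (cong (∑ xs f ⊕_) (∑-concat xss f))

∑-concatMap : {A B : Set} (g : A → List B) (xs : List A) (f : B → ℤ) → ∑ (concatMap g xs) f ≡ ∑ xs (λ x → ∑ (g x) f)
∑-concatMap g xs f = trans (∑-concat (map g xs) f) (∑-map g xs (λ ys → ∑ ys f))

∑-cong∈ : {A : Set} (xs : List A) {f g : A → ℤ} → (∀ x → x ∈ xs → f x ≡ g x) → ∑ xs f ≡ ∑ xs g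
∑-cong∈ [] e = refl
∑-cong∈ (x ∷ xs) e = cong₂ _⊕_ (e x (here refl)) (∑-cong∈ xs (λ y y∈ → e y (there y∈)))

∑-cong : {A : Set} (xs : List A) {f g : A → ℤ} → (∀ x → f x ≡ g x) → ∑ xs f ≡ ∑ xs g
∑-cong xs e = ∑-cong∈ xs (λ x _ → e x)

∑-congAll : {A : Set} {P : A → Set} (xs : List A) {f g : A → ℤ} → All P xs → (∀ x → P x → f x ≡ g x) → ∑ xs f ≡ ∑ xs g
∑-congAll xs ps e = ∑-cong∈ xs (λ x x∈ → e x (All.lookup ps x∈))

∑-zero : {A : Set} (xs : List A) → ∑ xs (λ _ → + 0) ≡ + 0
∑-zero [] = refl
∑-zero (x ∷ xs) = trans (ℤP.+-identityˡ _) (∑-zero xs)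

∑-*ˡ : {A : Set} (c : ℤ) (xs : List A) (f : A → ℤ) → ∑ xs (λ x → c * f x) ≡ c * ∑ xs f
∑-*ˡ c [] f = sym (ℤP.*-zeroʳ c)
∑-*ˡ c (x ∷ xs) f = trans (cong (c * f x ⊕_) (∑-*ˡ c xs f)) (sym (ℤP.*-distribˡ-+ c (f x) _))

∑-*ʳ : {A : Set} (c : ℤ) (xs : List A) (f : A → ℤ) → ∑ xs (λ x → f x * c) ≡ ∑ xs f * c
∑-*ʳ c xs f = trans (∑-cong xs (λ x → ℤP.*-comm (f x) c)) (trans (∑-*ˡ c xs f) (ℤP.*-comm c _))

∑-filter : {A : Set} {P : A → Set} (P? : Relation.Unary.Decidable P) (xs : List A) (f : A → ℤ) →
  ∑ (filter P? xs) f ≡ ∑ xs (λ x → if does (P? x) then f x else + 0)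
∑-filter P? [] f = refl
∑-filter P? (x ∷ xs) f with does (P? x)
... | true = cong (f x ⊕_) (∑-filter P? xs f)
... | false = trans (∑-filter P? xs f) (sym (ℤP.+-identityˡ _))

∑-filterᵇ : {A : Set} (p : A → Bool) (xs : List A) (f : A → ℤ) → ∑ (filterᵇ p xs) f ≡ ∑ xs (λ x → if p x then f x else + 0)
∑-filterᵇ p = ∑-filter (λ x → T? (p x))

^-distribʳ-* : ∀ a b n → (a * b) ^ n ≡ a ^ n * b ^ n
^-distribʳ-* a b zero = refl
^-distribʳ-* a b (suc n) = trans (cong ((a * b) *_) (^-distribʳ-* a b n)) (interchange a b (a ^ n) (b ^ n))
  where
  interchange : ∀ a b c d → (a * b) * (c * d) ≡ (a * c) * (b * d)
  interchange = solve-∀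

bit : Bool → ℕ
bit b = if b then 1 else 0

sign : ℕ → ℤ
sign n = (- (+ 1)) ^ n

sign-+ : ∀ m n → sign (m ℕ.+ n) ≡ sign m * sign n
sign-+ = ℤP.^-distribˡ-+-* (- (+ 1))

sign-double : ∀ b → sign (bit b ℕ.+ bit b) ≡ + 1
sign-double true = refl
sign-double false = refl

∧-trueˡ : ∀ {a b} → a ∧ b ≡ true → a ≡ true
∧-trueˡ {true} _ = refl

∧-trueʳ : ∀ {a b} → a ∧ b ≡ true → b ≡ true
∧-trueʳ {true} e = e

T⇒≡true : ∀ {b} → T b → b ≡ true
T⇒≡true {true} _ = refl

≡true⇒T : ∀ {b} → b ≡ true → T b
≡true⇒T refl = _

<ᵇ-complete : ∀ {m n} → m ℕ.< n → (m ℕ.<ᵇ n) ≡ true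
<ᵇ-complete p = T⇒≡true (ℕP.<⇒<ᵇ p)

<ᵇ-sound : ∀ {m n} → (m ℕ.<ᵇ n) ≡ true → m ℕ.< n
<ᵇ-sound {m} {n} e = ℕP.<ᵇ⇒< m n (≡true⇒T e)

≮⇒<ᵇ-false : ∀ {m n} → ¬ (m ℕ.< n) → (m ℕ.<ᵇ n) ≡ false
≮⇒<ᵇ-false {m} {n} m≮n with m ℕ.<ᵇ n in e
... | true = ⊥-elim (m≮n (<ᵇ-sound e))
... | false = refl

<ᵇ-false⇒≮ : ∀ {m n} → (m ℕ.<ᵇ n) ≡ false → ¬ (m ℕ.< n)
<ᵇ-false⇒≮ e m<n with trans (sym e) (<ᵇ-complete m<n)
... | ()

<ᵇ-irrefl : ∀ b → (b ℕ.<ᵇ b) ≡ false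
<ᵇ-irrefl b = ≮⇒<ᵇ-false {b} {b} (ℕP.<-irrefl refl)

≡ᵇ-refl : ∀ n → (n ℕ.≡ᵇ n) ≡ true
≡ᵇ-refl n = T⇒≡true (ℕP.≡⇒≡ᵇ n n refl)

≡ᵇ-sound : ∀ {m n} → (m ℕ.≡ᵇ n) ≡ true → m ≡ n
≡ᵇ-sound {m} {n} e = ℕP.≡ᵇ⇒≡ m n (≡true⇒T e)

≢ᵇ-sound : ∀ {m n} → not (m ℕ.≡ᵇ n) ≡ true → m ≢ n
≢ᵇ-sound {m} e refl with trans (cong not (sym (≡ᵇ-refl m))) e
... | ()

∧-interchange : ∀ a b c d → (a ∧ b) ∧ (c ∧ d) ≡ (a ∧ c) ∧ (b ∧ d)
∧-interchange true true c d = refl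
∧-interchange true false true d = refl
∧-interchange true false false d = refl
∧-interchange false b c d = refl

∧-rotate : ∀ a b c d → (a ∧ b) ∧ (c ∧ d) ≡ a ∧ ((c ∧ b) ∧ d)
∧-rotate true true true d = refl
∧-rotate true true false d = refl
∧-rotate true false true d = refl
∧-rotate true false false d = refl
∧-rotate false b c d = refl

length-filterᵇ-∷ : ∀ {A : Set} (p : A → Bool) y w → length (filterᵇ p (y ∷ w)) ≡ bit (p y) ℕ.+ length (filterᵇ p w)
length-filterᵇ-∷ p y w with p y
... | true = refl
... | false = refl

-- Statistics of a word w (the list of its signed letters) relative to the list
-- F of absolute values already used by letters to its left.

fresh : ℕ → List ℕ → Bool
fresh c [] = true
fresh c (b ∷ F) = not (b ℕ.≡ᵇ c) ∧ fresh c F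

avoids : List ℕ → List ℤ → Bool
avoids F [] = true
avoids F (y ∷ w) = fresh ∣ y ∣ F ∧ avoids F w

absDistinct : List ℤ → Bool
absDistinct w = does (allPairs? (λ x y → ¬? (∣ x ∣ ℕ.≟ ∣ y ∣)) w)

absDistinctFrom : ℤ → List ℤ → Bool
absDistinctFrom x w = does (all? (λ y → ¬? (∣ x ∣ ℕ.≟ ∣ y ∣)) w)

nAbove : ℕ → List ℕ → ℕ
nAbove c [] = 0
nAbove c (f ∷ F) = bit (c ℕ.<ᵇ f) ℕ.+ nAbove c F

-- #{(f, y) : f ∈ F, y ∈ w, |y| < f}, the inversions between F and w
crossInv : List ℕ → List ℤ → ℕ
crossInv F [] = 0
crossInv F (y ∷ w) = nAbove ∣ y ∣ F ℕ.+ crossInv F w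

nBelow : ℕ → List ℤ → ℕ
nBelow c [] = 0
nBelow c (y ∷ w) = bit (∣ y ∣ ℕ.<ᵇ c) ℕ.+ nBelow c w

desFrom : ℤ → List ℤ → ℕ
desFrom p w = countAdj (λ x y → y <ᵇ x) (p ∷ w)

ascFrom : ℤ → List ℤ → ℕ
ascFrom p w = countAdj (λ x y → x <ᵇ y) (p ∷ w)

avoids-∷ : ∀ x F w → avoids (∣ x ∣ ∷ F) w ≡ absDistinctFrom x w ∧ avoids F w
avoids-∷ x F [] = refl
avoids-∷ x F (y ∷ w) =
  trans (cong ((not (∣ x ∣ ℕ.≡ᵇ ∣ y ∣) ∧ fresh ∣ y ∣ F) ∧_) (avoids-∷ x F w))
        (∧-interchange (not (∣ x ∣ ℕ.≡ᵇ ∣ y ∣)) (fresh ∣ y ∣ F) (absDistinctFrom x w) (avoids F w))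

guard-∷ : ∀ x F w → (avoids F (x ∷ w) ∧ absDistinct (x ∷ w)) ≡ fresh ∣ x ∣ F ∧ (avoids (∣ x ∣ ∷ F) w ∧ absDistinct w)
guard-∷ x F w =
  trans (∧-rotate (fresh ∣ x ∣ F) (avoids F w) (absDistinctFrom x w) (absDistinct w))
        (cong (λ z → fresh ∣ x ∣ F ∧ (z ∧ absDistinct w)) (sym (avoids-∷ x F w)))

crossInv-∷ : ∀ c F w → crossInv (c ∷ F) w ≡ nBelow c w ℕ.+ crossInv F w
crossInv-∷ c F [] = refl
crossInv-∷ c F (y ∷ w) =
  trans (cong ((bit (∣ y ∣ ℕ.<ᵇ c) ℕ.+ nAbove ∣ y ∣ F) ℕ.+_) (crossInv-∷ c F w))
        (shuffle (bit (∣ y ∣ ℕ.<ᵇ c)) (nBelow c w) (nAbove ∣ y ∣ F) (crossInv F w))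
  where
  shuffle : ∀ a b c d → (a ℕ.+ c) ℕ.+ (b ℕ.+ d) ≡ (a ℕ.+ b) ℕ.+ (c ℕ.+ d)
  shuffle = ℕSolver.solve-∀

pair-parity : ∀ x y → not (∣ x ∣ ℕ.≡ᵇ ∣ y ∣) ≡ true →
  sign (bit (y <ᵇ x) ℕ.+ bit (y <ᵇ (- x))) ≡ sign (bit (∣ y ∣ ℕ.<ᵇ ∣ x ∣))
pair-parity (+ zero) y h = sign-double (y <ᵇ (+ 0))
pair-parity (+ suc b) (+ a) h = cong sign (ℕP.+-identityʳ (bit (a ℕ.<ᵇ suc b)))
pair-parity (+ suc b) -[1+ a ] h with ℕP.<-cmp a b
... | tri< a<b _ _ rewrite <ᵇ-complete a<b | ≮⇒<ᵇ-false (ℕP.<⇒≯ a<b) = refl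
... | tri≈ _ a≡b _ = ⊥-elim (≢ᵇ-sound h (cong suc (sym a≡b)))
... | tri> _ _ b<a rewrite <ᵇ-complete b<a | ≮⇒<ᵇ-false (ℕP.<⇒≯ b<a) = refl
pair-parity -[1+ b ] (+ a) h = refl
pair-parity -[1+ b ] -[1+ a ] h with ℕP.<-cmp a b
... | tri< a<b _ _ rewrite <ᵇ-complete a<b | ≮⇒<ᵇ-false (ℕP.<⇒≯ a<b) = refl
... | tri≈ _ a≡b _ = ⊥-elim (≢ᵇ-sound h (cong suc (sym a≡b)))
... | tri> _ _ b<a rewrite <ᵇ-complete b<a | ≮⇒<ᵇ-false (ℕP.<⇒≯ b<a) = refl

first-letter-parity : ∀ x w → absDistinctFrom x w ≡ true →
  sign (length (filterᵇ (_<ᵇ x) w) ℕ.+ length (filterᵇ (_<ᵇ (- x)) w)) ≡ sign (nBelow ∣ x ∣ w)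
first-letter-parity x [] h = refl
first-letter-parity x (y ∷ w) h = begin
    sign (length (filterᵇ (_<ᵇ x) (y ∷ w)) ℕ.+ length (filterᵇ (_<ᵇ (- x)) (y ∷ w)))
  ≡⟨ cong₂ (λ a b → sign (a ℕ.+ b)) (length-filterᵇ-∷ (_<ᵇ x) y w) (length-filterᵇ-∷ (_<ᵇ (- x)) y w) ⟩
    sign ((P ℕ.+ A) ℕ.+ (Q ℕ.+ B))
  ≡⟨ cong sign (shuffle P Q A B) ⟩
    sign ((P ℕ.+ Q) ℕ.+ (A ℕ.+ B))
  ≡⟨ sign-+ (P ℕ.+ Q) (A ℕ.+ B) ⟩
    sign (P ℕ.+ Q) * sign (A ℕ.+ B)
  ≡⟨ cong₂ _*_ (pair-parity x y (∧-trueˡ h)) (first-letter-parity x w (∧-trueʳ h)) ⟩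
    sign (bit (∣ y ∣ ℕ.<ᵇ ∣ x ∣)) * sign (nBelow ∣ x ∣ w)
  ≡⟨ sym (sign-+ (bit (∣ y ∣ ℕ.<ᵇ ∣ x ∣)) (nBelow ∣ x ∣ w)) ⟩
    sign (nBelow ∣ x ∣ (y ∷ w)) ∎
  where
  open ≡-Reasoning
  P = bit (y <ᵇ x)
  Q = bit (y <ᵇ (- x))
  A = length (filterᵇ (_<ᵇ x) w)
  B = length (filterᵇ (_<ᵇ (- x)) w)
  shuffle : ∀ a b c d → (a ℕ.+ c) ℕ.+ (b ℕ.+ d) ≡ (a ℕ.+ b) ℕ.+ (c ℕ.+ d)
  shuffle = ℕSolver.solve-∀

inv-cons-parity : ∀ x F w → absDistinctFrom x w ≡ true →
  sign (invB (x ∷ w) ℕ.+ crossInv F (x ∷ w))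
    ≡ sign (bit (x <ᵇ (+ 0))) * sign (nAbove ∣ x ∣ F) * sign (invB w ℕ.+ crossInv (∣ x ∣ ∷ F) w)
inv-cons-parity x F w h = begin
    sign (invB (x ∷ w) ℕ.+ crossInv F (x ∷ w))
  ≡⟨ cong (λ z → sign ((((A1 ℕ.+ I1) ℕ.+ (A2 ℕ.+ I2)) ℕ.+ z) ℕ.+ (c ℕ.+ Cw))) (length-filterᵇ-∷ (_<ᵇ (+ 0)) x w) ⟩
    sign ((((A1 ℕ.+ I1) ℕ.+ (A2 ℕ.+ I2)) ℕ.+ (b ℕ.+ N)) ℕ.+ (c ℕ.+ Cw))
  ≡⟨ cong sign (regroup A1 A2 I1 I2 b N c Cw) ⟩
    sign ((b ℕ.+ c) ℕ.+ ((A1 ℕ.+ A2) ℕ.+ R))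
  ≡⟨ sign-+ (b ℕ.+ c) ((A1 ℕ.+ A2) ℕ.+ R) ⟩
    sign (b ℕ.+ c) * sign ((A1 ℕ.+ A2) ℕ.+ R)
  ≡⟨ cong₂ _*_ (sign-+ b c) (sign-+ (A1 ℕ.+ A2) R) ⟩
    sign b * sign c * (sign (A1 ℕ.+ A2) * sign R)
  ≡⟨ cong (λ z → sign b * sign c * (z * sign R)) (first-letter-parity x w h) ⟩
    sign b * sign c * (sign Lt * sign R)
  ≡⟨ cong (sign b * sign c *_) (sym (sign-+ Lt R)) ⟩
    sign b * sign c * sign (Lt ℕ.+ R)
  ≡⟨ cong (λ z → sign b * sign c * sign z) (sym cross-split) ⟩
    sign b * sign c * sign (invB w ℕ.+ crossInv (∣ x ∣ ∷ F) w) ∎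
  where
  open ≡-Reasoning
  A1 = length (filterᵇ (_<ᵇ x) w)
  A2 = length (filterᵇ (_<ᵇ (- x)) w)
  I1 = countPairs (λ x y → y <ᵇ x) w
  I2 = countPairs (λ x y → y <ᵇ (- x)) w
  N = length (filterᵇ (_<ᵇ (+ 0)) w)
  b = bit (x <ᵇ (+ 0))
  c = nAbove ∣ x ∣ F
  Cw = crossInv F w
  Lt = nBelow ∣ x ∣ w
  R = ((I1 ℕ.+ I2) ℕ.+ N) ℕ.+ Cw
  regroup : ∀ A1 A2 I1 I2 b N c Cw → (((A1 ℕ.+ I1) ℕ.+ (A2 ℕ.+ I2)) ℕ.+ (b ℕ.+ N)) ℕ.+ (c ℕ.+ Cw)
    ≡ (b ℕ.+ c) ℕ.+ ((A1 ℕ.+ A2) ℕ.+ (((I1 ℕ.+ I2) ℕ.+ N) ℕ.+ Cw))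
  regroup = ℕSolver.solve-∀
  swap : ∀ R L Cw → R ℕ.+ (L ℕ.+ Cw) ≡ L ℕ.+ (R ℕ.+ Cw)
  swap = ℕSolver.solve-∀
  cross-split : invB w ℕ.+ crossInv (∣ x ∣ ∷ F) w ≡ Lt ℕ.+ R
  cross-split = trans (cong (((I1 ℕ.+ I2) ℕ.+ N) ℕ.+_) (crossInv-∷ ∣ x ∣ F w)) (swap ((I1 ℕ.+ I2) ℕ.+ N) Lt Cw)

-- chains k l counts the strictly increasing sequences b₁ < … < b_k of entries
-- of l: choose b₁, then continue among the entries of l above it.
chains : ℕ → List ℕ → ℤ
chains zero l = + 1
chains (suc k) l = ∑ l (λ b → chains k (filterᵇ (b ℕ.<ᵇ_) l))

-- Keeping only the entries above a member b of l drops at least b itself.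
length-filter-above : ∀ b l → b ∈ l → length (filterᵇ (b ℕ.<ᵇ_) l) ℕ.< length l
length-filter-above b (c ∷ l) (here refl) rewrite <ᵇ-irrefl b = ℕ.s≤s (length-filter (λ x → T? (b ℕ.<ᵇ x)) l)
length-filter-above b (c ∷ l) (there b∈) with b ℕ.<ᵇ c
... | true = ℕ.s≤s (length-filter-above b l b∈)
... | false = ℕP.m<n⇒m<1+n (length-filter-above b l b∈)

chains-short : ∀ k l → length l ℕ.< k → chains k l ≡ + 0
chains-short (suc k) l h =
  trans (∑-cong∈ l (λ b b∈ → chains-short k _ (ℕP.<-≤-trans (length-filter-above b l b∈) (ℕP.≤-pred h))))
        (∑-zero l)

filter-above-all : ∀ b l → All (b ℕ.<_) l → filterᵇ (b ℕ.<ᵇ_) l ≡ l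
filter-above-all b [] _ = refl
filter-above-all b (c ∷ l) (h ∷ hs) rewrite <ᵇ-complete h = cong (c ∷_) (filter-above-all b l hs)

chains-sorted : ∀ l → AllPairs ℕ._<_ l → chains (length l) l ≡ + 1
chains-sorted [] _ = refl
chains-sorted (b ∷ bs) (b<bs AllPairs.∷ sorted) = cong₂ _⊕_ start-at-b start-later
  where
  start-at-b : chains (length bs) (filterᵇ (b ℕ.<ᵇ_) (b ∷ bs)) ≡ + 1
  start-at-b rewrite <ᵇ-irrefl b | filter-above-all b bs b<bs = chains-sorted bs sorted
  too-short : ∀ c → c ∈ bs → chains (length bs) (filterᵇ (c ℕ.<ᵇ_) (b ∷ bs)) ≡ + 0
  too-short c c∈ rewrite ≮⇒<ᵇ-false {c} {b} (ℕP.<⇒≯ (All.lookup b<bs c∈)) =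
    chains-short (length bs) _ (length-filter-above c bs c∈)
  start-later : ∑ bs (λ c → chains (length bs) (filterᵇ (c ℕ.<ᵇ_) (b ∷ bs))) ≡ + 0
  start-later = trans (∑-cong∈ bs too-short) (∑-zero bs)

fresh-above : ∀ {q b} F → All (ℕ._≤ q) F → q ℕ.< b → fresh b F ≡ true
fresh-above [] _ _ = refl
fresh-above {q} {b} (f ∷ F) (f≤q ∷ F≤q) q<b with f ℕ.≡ᵇ b in e
... | true = ⊥-elim (ℕP.<-irrefl (≡ᵇ-sound e) (ℕP.≤-<-trans f≤q q<b))
... | false = fresh-above F F≤q q<b

nAbove-above : ∀ {q b} F → All (ℕ._≤ q) F → q ℕ.< b → nAbove b F ≡ 0
nAbove-above [] _ _ = refl
nAbove-above {q} {b} (f ∷ F) (f≤q ∷ F≤q) q<b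
  rewrite ≮⇒<ᵇ-false {b} {f} (ℕP.<⇒≯ (ℕP.≤-<-trans f≤q q<b)) = nAbove-above F F≤q q<b

filter-above-twice : ∀ q b l → q ℕ.< b → filterᵇ (b ℕ.<ᵇ_) (filterᵇ (q ℕ.<ᵇ_) l) ≡ filterᵇ (b ℕ.<ᵇ_) l
filter-above-twice q b [] _ = refl
filter-above-twice q b (c ∷ l) q<b with q ℕ.<ᵇ c in e₁
... | true with b ℕ.<ᵇ c
...   | true = cong (c ∷_) (filter-above-twice q b l q<b)
...   | false = filter-above-twice q b l q<b
filter-above-twice q b (c ∷ l) q<b | false with b ℕ.<ᵇ c in e₂
...   | false = filter-above-twice q b l q<b
...   | true = ⊥-elim (<ᵇ-false⇒≮ {q} {c} e₁ (ℕP.<-trans q<b (<ᵇ-sound {b} {c} e₂)))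

-- The first-letter recursion.  Letters are ±b for b in the list `as` of
-- positive values, all bounded by M (which will be aₙ).
module FirstLetter (as : List ℕ) (M : ℕ) (t s : ℤ) (bounds : All (λ b → 0 ℕ.< b × b ℕ.≤ M) as) where

  letters : List ℤ
  letters = concatMap (λ b → (+ b) ∷ (- (+ b)) ∷ []) as

  weight : List ℕ → ℤ → ℤ → List ℤ → ℤ
  weight F p u w = sign (invB w ℕ.+ crossInv F w) * t ^ desFrom p w * s ^ ascFrom p w * u ^ posOfAbs M w

  S : ℕ → List ℕ → ℤ → ℤ → ℤ
  S k F p u = ∑ (words letters k) (λ w → if avoids F w ∧ absDistinct w then weight F p u w else + 0)

  coeff : ℕ → List ℕ → ℕ → ℤ
  coeff zero F q = + 1
  coeff (suc k) F q = ∑ as (λ b → if (q ℕ.<ᵇ b) ∧ fresh b F then sign (nAbove b F) * coeff k (b ∷ F) b else + 0)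

  -- u marks the letters up to the one of absolute value M, and is 1 after it.
  uAfter : ℤ → ℤ → ℤ
  uAfter x u = if ∣ x ∣ ℕ.≡ᵇ M then + 1 else u

  stepWeight : ℤ → ℤ → ℤ
  stepWeight p x = t ^ bit (x <ᵇ p) * s ^ bit (p <ᵇ x)

  letterWeight : List ℕ → ℤ → ℤ → ℤ → ℤ
  letterWeight F p u x = sign (bit (x <ᵇ (+ 0))) * sign (nAbove ∣ x ∣ F) * stepWeight p x * u

  u^pos-∷ : ∀ x w u → u ^ posOfAbs M (x ∷ w) ≡ u * (uAfter x u) ^ posOfAbs M w
  u^pos-∷ x w u with ∣ x ∣ ℕ.≡ᵇ M
  ... | true = cong (u *_) (sym (ℤP.^-zeroˡ (posOfAbs M w)))
  ... | false = refl

  weight-∷ : ∀ F p u x w → absDistinctFrom x w ≡ true →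
    weight F p u (x ∷ w) ≡ letterWeight F p u x * weight (∣ x ∣ ∷ F) x (uAfter x u) w
  weight-∷ F p u x w h = begin
      sign (invB (x ∷ w) ℕ.+ crossInv F (x ∷ w)) * t ^ (bit (x <ᵇ p) ℕ.+ desFrom x w)
        * s ^ (bit (p <ᵇ x) ℕ.+ ascFrom x w) * u ^ posOfAbs M (x ∷ w)
    ≡⟨ cong₂ _*_ (cong₂ _*_ (cong₂ _*_ (inv-cons-parity x F w h) (ℤP.^-distribˡ-+-* t (bit (x <ᵇ p)) (desFrom x w)))
                                     (ℤP.^-distribˡ-+-* s (bit (p <ᵇ x)) (ascFrom x w)))
                 (u^pos-∷ x w u) ⟩
      (sb * sc * sr) * (t ^ bit (x <ᵇ p) * t ^ desFrom x w) * (s ^ bit (p <ᵇ x) * s ^ ascFrom x w)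
        * (u * (uAfter x u) ^ posOfAbs M w)
    ≡⟨ regroup sb sc sr (t ^ bit (x <ᵇ p)) (t ^ desFrom x w) (s ^ bit (p <ᵇ x)) (s ^ ascFrom x w) u ((uAfter x u) ^ posOfAbs M w) ⟩
      letterWeight F p u x * weight (∣ x ∣ ∷ F) x (uAfter x u) w ∎
    where
    open ≡-Reasoning
    sb = sign (bit (x <ᵇ (+ 0)))
    sc = sign (nAbove ∣ x ∣ F)
    sr = sign (invB w ℕ.+ crossInv (∣ x ∣ ∷ F) w)
    regroup : ∀ sb sc sr ta td sa sd u ur → (sb * sc * sr) * (ta * td) * (sa * sd) * (u * ur)
          ≡ (sb * sc * (ta * sa) * u) * (sr * td * sd * ur)
    regroup = solve-∀

  words-from : ∀ k F p u x (b : Bool) →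
    ∑ (words letters k) (λ w → if b ∧ (avoids (∣ x ∣ ∷ F) w ∧ absDistinct w) then weight F p u (x ∷ w) else + 0)
      ≡ (if b then letterWeight F p u x * S k (∣ x ∣ ∷ F) x (uAfter x u) else + 0)
  words-from k F p u x false = ∑-zero (words letters k)
  words-from k F p u x true = trans (∑-cong (words letters k) factor) (∑-*ˡ (letterWeight F p u x) (words letters k) _)
    where
    factor : ∀ w → (if avoids (∣ x ∣ ∷ F) w ∧ absDistinct w then weight F p u (x ∷ w) else + 0)
          ≡ letterWeight F p u x * (if avoids (∣ x ∣ ∷ F) w ∧ absDistinct w then weight (∣ x ∣ ∷ F) x (uAfter x u) w else + 0)
    factor w with avoids (∣ x ∣ ∷ F) w ∧ absDistinct w in eq
    ... | true = weight-∷ F p u x w (∧-trueˡ (trans (sym (avoids-∷ x F w)) (∧-trueˡ eq)))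
    ... | false = sym (ℤP.*-zeroʳ (letterWeight F p u x))

  S-step : ∀ k F p u →
    S (suc k) F p u ≡ ∑ letters (λ x → if fresh ∣ x ∣ F then letterWeight F p u x * S k (∣ x ∣ ∷ F) x (uAfter x u) else + 0)
  S-step k F p u = begin
      S (suc k) F p u
    ≡⟨ ∑-concatMap (λ x → map (x ∷_) (words letters k)) letters guarded ⟩
      ∑ letters (λ x → ∑ (map (x ∷_) (words letters k)) guarded)
    ≡⟨ ∑-cong letters (λ x → ∑-map (x ∷_) (words letters k) guarded) ⟩
      ∑ letters (λ x → ∑ (words letters k) (λ w → guarded (x ∷ w)))
    ≡⟨ ∑-cong letters (λ x → trans (∑-cong (words letters k) (λ w → cong (λ z → if z then weight F p u (x ∷ w) else + 0) (guard-∷ x F w)))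
                                    (words-from k F p u x (fresh ∣ x ∣ F))) ⟩
      ∑ letters (λ x → if fresh ∣ x ∣ F then letterWeight F p u x * S k (∣ x ∣ ∷ F) x (uAfter x u) else + 0) ∎
    where
    open ≡-Reasoning
    guarded : List ℤ → ℤ
    guarded w = if avoids F w ∧ absDistinct w then weight F p u w else + 0

  ascent : t ^ 0 * s ^ 1 ≡ s
  ascent = trans (ℤP.*-identityˡ _) (ℤP.*-identityʳ s)

  descent : t ^ 1 * s ^ 0 ≡ t
  descent = trans (ℤP.*-identityʳ _) (ℤP.*-identityʳ t)

  pair-above : ∀ p b' → (∣ p ∣ ℕ.<ᵇ suc b') ≡ true →
    (stepWeight p (+ suc b') ≡ s) × (stepWeight p -[1+ b' ] ≡ t)
  pair-above (+ n) b' h =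
    trans (cong₂ (λ a c → t ^ bit a * s ^ bit c) {x = (+ suc b') <ᵇ (+ n)} {u = (+ n) <ᵇ (+ suc b')}
                 (≮⇒<ᵇ-false {suc b'} {n} (ℕP.<⇒≯ (<ᵇ-sound {n} {suc b'} h))) h)
          ascent
    , descent
  pair-above -[1+ n ] b' h =
    ascent
    , trans (cong₂ (λ a c → t ^ bit a * s ^ bit c) {x = -[1+ b' ] <ᵇ -[1+ n ]} {u = -[1+ n ] <ᵇ -[1+ b' ]}
                   h (≮⇒<ᵇ-false (ℕP.<⇒≯ (<ᵇ-sound {n} {b'} h))))
            descent

  -- If b > |p| fails and b ≠ |p|, then +b and -b lie on the same side of p.
  pair-below : ∀ p b' → (∣ p ∣ ℕ.<ᵇ suc b') ≡ false → suc b' ≢ ∣ p ∣ →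
    stepWeight p (+ suc b') ≡ stepWeight p -[1+ b' ]
  pair-below (+ n) b' h b≢p = cong₂ (λ a c → t ^ bit a * s ^ bit c) {x = (+ suc b') <ᵇ (+ n)} {u = (+ n) <ᵇ (+ suc b')}
    (<ᵇ-complete (ℕP.≤∧≢⇒< (ℕP.≮⇒≥ (<ᵇ-false⇒≮ {n} {suc b'} h)) b≢p)) h
  pair-below -[1+ n ] b' h b≢p = cong₂ (λ a c → t ^ bit a * s ^ bit c) {x = false} {y = -[1+ b' ] <ᵇ -[1+ n ]} {u = true}
    {v = -[1+ n ] <ᵇ -[1+ b' ]} (sym h)
    (sym (<ᵇ-complete (ℕP.≤∧≢⇒< (ℕP.≮⇒≥ (<ᵇ-false⇒≮ {n} {b'} h)) (λ e → b≢p (cong suc e)))))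

  -- The invariant of the recursion: the previous letter p has a used absolute
  -- value, so no fresh positive value equals |p|.
  PrevUsed : List ℕ → ℤ → Set
  PrevUsed F p = ∀ c → 0 ℕ.< c → fresh c F ≡ true → c ≢ ∣ p ∣

  PrevUsed-∷ : ∀ F x → PrevUsed (∣ x ∣ ∷ F) x
  PrevUsed-∷ F x c _ c-fresh c≡x = ≢ᵇ-sound (∧-trueˡ c-fresh) (sym c≡x)

  coeff-at-max : ∀ k F → coeff (suc k) F M ≡ + 0
  coeff-at-max k F = trans (∑-congAll as bounds none-above) (∑-zero as)
    where
    none-above : ∀ b → (0 ℕ.< b × b ℕ.≤ M) →
      (if (M ℕ.<ᵇ b) ∧ fresh b F then sign (nAbove b F) * coeff k (b ∷ F) b else + 0) ≡ + 0
    none-above b (_ , b≤M) rewrite ≮⇒<ᵇ-false {M} {b} (ℕP.≤⇒≯ b≤M) = refl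

  -- Resetting u after the letter of absolute value M is harmless: what
  -- remains after it contributes only for k = 0.
  coeff-ignores-u : ∀ k F b u →
    coeff k (b ∷ F) b * ((s - t) * uAfter (+ b) u) ^ k ≡ coeff k (b ∷ F) b * ((s - t) * u) ^ k
  coeff-ignores-u k F b u with b ℕ.≡ᵇ M in b≡M
  ... | false = refl
  coeff-ignores-u zero F b u | true = refl
  coeff-ignores-u (suc k) F b u | true =
    trans (cong (_* Xₘ) no-chain) (trans (ℤP.*-zeroˡ Xₘ) (sym (trans (cong (_* X) no-chain) (ℤP.*-zeroˡ X))))
    where
    Xₘ = ((s - t) * + 1) ^ suc k
    X = ((s - t) * u) ^ suc k
    no-chain : coeff (suc k) (b ∷ F) b ≡ + 0
    no-chain = subst (λ z → coeff (suc k) (z ∷ F) z ≡ + 0) (sym (≡ᵇ-sound b≡M)) (coeff-at-max k (M ∷ F))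

  firstLetterTerm : ℕ → List ℕ → ℤ → ℤ → ℤ → ℤ
  firstLetterTerm k F p u x = if fresh ∣ x ∣ F then letterWeight F p u x * S k (∣ x ∣ ∷ F) x (uAfter x u) else + 0

  pair-contribution : ∀ k F p u b' → PrevUsed F p →
    (∀ F' p' u' → PrevUsed F' p' → S k F' p' u' ≡ coeff k F' ∣ p' ∣ * ((s - t) * u') ^ k) →
    firstLetterTerm k F p u (+ suc b') ⊕ (firstLetterTerm k F p u -[1+ b' ] ⊕ + 0)
      ≡ (if (∣ p ∣ ℕ.<ᵇ suc b') ∧ fresh (suc b') F then sign (nAbove (suc b') F) * coeff k (suc b' ∷ F) (suc b') else + 0)
          * ((s - t) * u) ^ suc k
  pair-contribution k F p u b' prev closed with fresh (suc b') F in b-fresh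
  ... | false = sym (trans (cong (λ z → (if z then _ else + 0) * X) (∧-zeroʳ (∣ p ∣ ℕ.<ᵇ suc b'))) (ℤP.*-zeroˡ X))
    where X = ((s - t) * u) ^ suc k
  ... | true = begin
      letterWeight F p u (+ suc b') * S k (suc b' ∷ F) (+ suc b') (uAfter (+ suc b') u)
        ⊕ (letterWeight F p u -[1+ b' ] * S k (suc b' ∷ F) -[1+ b' ] (uAfter -[1+ b' ] u) ⊕ + 0)
    ≡⟨ cong₂ (λ A B → letterWeight F p u (+ suc b') * A ⊕ (letterWeight F p u -[1+ b' ] * B ⊕ + 0)) (rest (+ suc b')) (rest -[1+ b' ]) ⟩
      ((+ 1) * σ * stepWeight p (+ suc b') * u) * Y ⊕ ((((- (+ 1)) * (+ 1)) * σ * stepWeight p -[1+ b' ] * u) * Y ⊕ + 0)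
    ≡⟨ opposite-signs σ (stepWeight p (+ suc b')) (stepWeight p -[1+ b' ]) u Y ⟩
      (stepWeight p (+ suc b') - stepWeight p -[1+ b' ]) * (σ * u * Y)
    ≡⟨ compare (∣ p ∣ ℕ.<ᵇ suc b') refl ⟩
      (if (∣ p ∣ ℕ.<ᵇ suc b') ∧ true then σ * Ck else + 0) * ((s - t) * u) ^ suc k ∎
    where
    open ≡-Reasoning
    σ = sign (nAbove (suc b') F)
    Ck = coeff k (suc b' ∷ F) (suc b')
    Y = Ck * ((s - t) * u) ^ k
    -- both letters ±b leave the same remaining sum
    rest : ∀ x → S k (∣ x ∣ ∷ F) x (uAfter x u) ≡ coeff k (∣ x ∣ ∷ F) ∣ x ∣ * ((s - t) * u) ^ k
    rest x = trans (closed (∣ x ∣ ∷ F) x (uAfter x u) (PrevUsed-∷ F x)) (coeff-ignores-u k F ∣ x ∣ u)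
    opposite-signs : ∀ σ W₊ W₋ u Y → ((+ 1) * σ * W₊ * u) * Y ⊕ ((((- (+ 1)) * (+ 1)) * σ * W₋ * u) * Y ⊕ + 0)
      ≡ (W₊ - W₋) * (σ * u * Y)
    opposite-signs = solve-∀
    factor : ∀ a c σ u C Xk → (a - c) * (σ * u * (C * Xk)) ≡ (σ * C) * (((a - c) * u) * Xk)
    factor = solve-∀
    compare : (w : Bool) → (∣ p ∣ ℕ.<ᵇ suc b') ≡ w →
      (stepWeight p (+ suc b') - stepWeight p -[1+ b' ]) * (σ * u * Y) ≡ (if w ∧ true then σ * Ck else + 0) * ((s - t) * u) ^ suc k
    compare true above =
      trans (cong₂ (λ A B → (A - B) * (σ * u * Y)) (proj₁ (pair-above p b' above)) (proj₂ (pair-above p b' above)))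
            (factor s t σ u Ck (((s - t) * u) ^ k))
    compare false below =
      trans (cong (λ A → (A - stepWeight p -[1+ b' ]) * (σ * u * Y)) (pair-below p b' below (prev (suc b') (ℕ.s≤s ℕ.z≤n) b-fresh)))
      (trans (cong (_* (σ * u * Y)) (ℤP.+-inverseʳ (stepWeight p -[1+ b' ])))
      (trans (ℤP.*-zeroˡ (σ * u * Y)) (sym (ℤP.*-zeroˡ (((s - t) * u) ^ suc k)))))

  partial-closed-form : ∀ k F p u → PrevUsed F p → S k F p u ≡ coeff k F ∣ p ∣ * ((s - t) * u) ^ k
  partial-closed-form zero F p u prev = refl
  partial-closed-form (suc k) F p u prev = begin
      S (suc k) F p u
    ≡⟨ S-step k F p u ⟩
      ∑ letters (firstLetterTerm k F p u)
    ≡⟨ ∑-concatMap (λ b → (+ b) ∷ (- (+ b)) ∷ []) as (firstLetterTerm k F p u) ⟩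
      ∑ as (λ b → firstLetterTerm k F p u (+ b) ⊕ (firstLetterTerm k F p u (- (+ b)) ⊕ + 0))
    ≡⟨ ∑-congAll as bounds by-pairs ⟩
      ∑ as (λ b → (if (∣ p ∣ ℕ.<ᵇ b) ∧ fresh b F then sign (nAbove b F) * coeff k (b ∷ F) b else + 0) * ((s - t) * u) ^ suc k)
    ≡⟨ ∑-*ʳ (((s - t) * u) ^ suc k) as _ ⟩
      coeff (suc k) F ∣ p ∣ * ((s - t) * u) ^ suc k ∎
    where
    open ≡-Reasoning
    by-pairs : ∀ b → (0 ℕ.< b × b ℕ.≤ M) →
      firstLetterTerm k F p u (+ b) ⊕ (firstLetterTerm k F p u (- (+ b)) ⊕ + 0)
        ≡ (if (∣ p ∣ ℕ.<ᵇ b) ∧ fresh b F then sign (nAbove b F) * coeff k (b ∷ F) b else + 0) * ((s - t) * u) ^ suc k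
    by-pairs (suc b') _ = pair-contribution k F p u b' prev (partial-closed-form k)

  -- When all used values are at most q, no sign arises and coeff counts the
  -- increasing chains above q.
  coeff-chains : ∀ k F q → All (ℕ._≤ q) F → coeff k F q ≡ chains k (filterᵇ (q ℕ.<ᵇ_) as)
  coeff-chains zero F q F≤q = refl
  coeff-chains (suc k) F q F≤q =
    trans (∑-cong as per-value) (sym (∑-filterᵇ (q ℕ.<ᵇ_) as (λ b → chains k (filterᵇ (b ℕ.<ᵇ_) (filterᵇ (q ℕ.<ᵇ_) as)))))
    where
    per-value : ∀ b → (if (q ℕ.<ᵇ b) ∧ fresh b F then sign (nAbove b F) * coeff k (b ∷ F) b else + 0)
             ≡ (if q ℕ.<ᵇ b then chains k (filterᵇ (b ℕ.<ᵇ_) (filterᵇ (q ℕ.<ᵇ_) as)) else + 0)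
    per-value b with q ℕ.<ᵇ b in q<ᵇb
    ... | false = refl
    ... | true rewrite fresh-above {q} {b} F F≤q (<ᵇ-sound q<ᵇb) | nAbove-above {q} {b} F F≤q (<ᵇ-sound q<ᵇb) =
      trans (ℤP.*-identityˡ _)
            (trans (coeff-chains k (b ∷ F) b (ℕP.≤-refl ∷ All.map (λ f≤q → ℕP.≤-trans f≤q (ℕP.<⇒≤ (<ᵇ-sound q<ᵇb))) F≤q))
                   (cong (chains k) (sym (filter-above-twice q b as (<ᵇ-sound q<ᵇb)))))

avoids-[] : ∀ w → avoids [] w ≡ true
avoids-[] [] = refl
avoids-[] (y ∷ w) = avoids-[] w

crossInv-[] : ∀ w → crossInv [] w ≡ 0
crossInv-[] [] = refl
crossInv-[] (y ∷ w) = crossInv-[] w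

module Setting (m : ℕ) (a : Fin (suc m) → ℕ) (a₁>0 : 0 < a zero) (increasing : ∀ i j → toℕ i < toℕ j → a i < a j)
               (t s : ℤ) where

  positive : ∀ i → 0 < a i
  positive zero = a₁>0
  positive (Data.Fin.suc j) = ℕP.<-trans a₁>0 (increasing zero (Data.Fin.suc j) (ℕ.s≤s ℕ.z≤n))

  bounded : ∀ i → a i ℕ.≤ a (fromℕ m)
  bounded i with ℕP.m≤n⇒m<n∨m≡n (subst (toℕ i ℕ.≤_) (sym (FinP.toℕ-fromℕ m)) (FinP.toℕ≤pred[n] i))
  ... | inj₁ i<n = ℕP.<⇒≤ (increasing i (fromℕ m) i<n)
  ... | inj₂ i≡n = ℕP.≤-reflexive (cong a (FinP.toℕ-injective i≡n))

  values : List ℕ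
  values = tabulate a

  values-bounds : All (λ b → 0 ℕ.< b × b ℕ.≤ a (fromℕ m)) values
  values-bounds = AllP.tabulate⁺ (λ i → positive i , bounded i)

  values-sorted : AllPairs ℕ._<_ values
  values-sorted = AllPairsP.tabulate⁺-< (λ {i} {j} i<j → increasing i j i<j)

  open FirstLetter values (a (fromℕ m)) t s values-bounds public

  genSum≡S : ∀ u → genSum a (a (fromℕ m)) t s u ≡ S (suc m) [] (+ 0) u
  genSum≡S u = begin
      genSum a (a (fromℕ m)) t s u
    ≡⟨ ∑-filter (allPairs? (λ x y → ¬? (∣ x ∣ ℕ.≟ ∣ y ∣))) (words (signedValues a) (suc m)) term ⟩
      ∑ (words (signedValues a) (suc m)) (λ w → if absDistinct w then term w else + 0)
    ≡⟨ cong (λ L → ∑ (words L (suc m)) (λ w → if absDistinct w then term w else + 0)) signedValues≡letters ⟩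
      ∑ (words letters (suc m)) (λ w → if absDistinct w then term w else + 0)
    ≡⟨ ∑-cong (words letters (suc m)) per-word ⟩
      S (suc m) [] (+ 0) u ∎
    where
    open ≡-Reasoning
    term : List ℤ → ℤ
    term π = ((- (+ 1)) ^ invB π) * (t ^ desB π) * (s ^ ascB π) * (u ^ posOfAbs (a (fromℕ m)) π)
    signedValues≡letters : signedValues a ≡ letters
    signedValues≡letters = trans (cong concat (map-tabulate id (λ j → (+ a j) ∷ (- (+ a j)) ∷ [])))
                                 (sym (cong concat (map-tabulate a (λ b → (+ b) ∷ (- (+ b)) ∷ []))))
    per-word : ∀ w → (if absDistinct w then term w else + 0)
      ≡ (if avoids [] w ∧ absDistinct w then weight [] (+ 0) u w else + 0)
    per-word w rewrite avoids-[] w | crossInv-[] w | ℕP.+-identityʳ (invB w) = refl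

  unique-full-chain : chains (suc m) (filterᵇ (0 ℕ.<ᵇ_) values) ≡ + 1
  unique-full-chain =
    trans (cong (chains (suc m)) (filter-above-all 0 values (AllP.tabulate⁺ positive)))
          (subst (λ k → chains k values ≡ + 1) (length-tabulate a) (chains-sorted values values-sorted))

theorem20 : (m : ℕ) → (a : Fin (suc m) → ℕ) → 0 < a zero
    → (∀ i j → toℕ i < toℕ j → a i < a j)
    → ∀ (t s u : ℤ) → genSum a (a (fromℕ m)) t s u ≡ ((s - t) ^ suc m) * (u ^ suc m)
theorem20 m a a₁>0 increasing t s u = begin
    genSum a (a (fromℕ m)) t s u
  ≡⟨ genSum≡S u ⟩
    S (suc m) [] (+ 0) u
  ≡⟨ partial-closed-form (suc m) [] (+ 0) u nothing-used ⟩
    coeff (suc m) [] 0 * ((s - t) * u) ^ suc m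
  ≡⟨ cong (_* ((s - t) * u) ^ suc m) (trans (coeff-chains (suc m) [] 0 []) unique-full-chain) ⟩
    + 1 * ((s - t) * u) ^ suc m
  ≡⟨ trans (ℤP.*-identityˡ _) (^-distribʳ-* (s - t) u (suc m)) ⟩
    ((s - t) ^ suc m) * (u ^ suc m) ∎
  where
  open ≡-Reasoning
  open Setting m a a₁>0 increasing t s
  nothing-used : PrevUsed [] (+ 0)
  nothing-used c c>0 _ c≡0 = ℕP.<-irrefl (sym c≡0) c>0
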